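{- Let $M=(E,r)$ be a matroid with $|E|=n$. The size-rank-coloop data of $M$ can be computed from $\mathcal{G}(M)$; that is, any two matroids with the same $\mathcal{G}$-invariant have the same size-rank-coloop data.
   Context: For a rank-$k$ matroid $M$ on an $n$-set $E$ and a bijection $\pi:[n]\to E$, the rank sequence $\underline{r}(\pi)=r_1\cdots r_n$ has $r_i=r(\{\pi(1),\dots,\pi(i)\})-r(\{\pi(1),\dots,\pi(i-1)\})$, and $\mathcal{G}(M)=\sum_\pi[\underline{r}(\pi)]$, a formal linear combination (over a field of characteristic zero) of symbols indexed by 0/1 sequences. The size-rank-coloop data of $M$ is the multiset of triples $(|S|,r(S),c(S))$ over all $S\subseteq E$, where $c(S)$ is the number of coloops of $M|S$. -}

module Defs where

open import Data.Nat using (ℕ; zero; suc; _+_; _∸_; _≤_; _<ᵇ_; _≡ᵇ_)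
open import Data.Bool using (Bool; true; false; _∧_; if_then_else_)
open import Data.Fin using (Fin)
open import Data.Fin.Subset using (Subset; _∪_; _∩_; _⊆_; ∣_∣; ⁅_⁆)
open import Data.Vec using (Vec; []; _∷_; lookup; _[_]≔_; toList)
open import Data.List using (List; []; _∷_; map; concatMap; allFin)
open import Data.Bool.ListAction using (all; any)
open import Data.Product using (_×_; _,_)
open import Relation.Binary.PropositionalEquality using (_≡_)
open import Relation.Nullary.Decidable using (⌊_⌋)
import Data.Fin as F

record Matroid (n : ℕ) : Set where
  field
    rank       : Subset n → ℕ
    rank-bound : ∀ X → rank X ≤ ∣ X ∣
    rank-mono  : ∀ {X Y} → X ⊆ Y → rank X ≤ rank Y
    rank-submod : ∀ X Y → rank (X ∪ Y) + rank (X ∩ Y) ≤ rank X + rank Y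
open Matroid public

count : {A : Set} → (A → Bool) → List A → ℕ
count p [] = 0
count p (x ∷ xs) = if p x then suc (count p xs) else count p xs

allVecs : {A : Set} → List A → (k : ℕ) → List (Vec A k)
allVecs xs zero = [] ∷ []
allVecs xs (suc k) = concatMap (λ x → map (x ∷_) (allVecs xs k)) xs

-- a sequence (π(1),…,π(n)) in Fin n is a bijection [n] → Fin n
-- iff every element of Fin n occurs in it
isBijection : {n : ℕ} → Vec (Fin n) n → Bool
isBijection {n} v = all (λ j → any (λ x → ⌊ j F.≟ x ⌋) (toList v)) (allFin n)

rankSeqFrom : {n k : ℕ} → (Subset n → ℕ) → Subset n → Vec (Fin n) k → List ℕ
rankSeqFrom r acc [] = []
rankSeqFrom r acc (x ∷ xs) = (r (acc ∪ ⁅ x ⁆) ∸ r acc) ∷ rankSeqFrom r (acc ∪ ⁅ x ⁆) xs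

rankSeq : {n : ℕ} → Matroid n → Vec (Fin n) n → List ℕ
rankSeq M π = rankSeqFrom (rank M) Data.Fin.Subset.⊥ π

listEqᵇ : List ℕ → List ℕ → Bool
listEqᵇ [] [] = true
listEqᵇ [] (_ ∷ _) = false
listEqᵇ (_ ∷ _) [] = false
listEqᵇ (a ∷ as) (b ∷ bs) = (a ≡ᵇ b) ∧ listEqᵇ as bs

-- The G-invariant as a formal linear combination of symbols [s]:
-- the coefficient of [s] is the number of bijections π with rank sequence s.
-- (Coefficients are naturals, which embed injectively in any char-0 field.)
Ginv : {n : ℕ} → Matroid n → List ℕ → ℕ
Ginv {n} M s =
  count (λ π → isBijection π ∧ listEqᵇ (rankSeq M π) s) (allVecs (allFin n) n)

allSubsets : (n : ℕ) → List (Subset n)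
allSubsets n = allVecs (true ∷ false ∷ []) n

coloops : {n : ℕ} → Matroid n → Subset n → ℕ
coloops {n} M S =
  count (λ e → lookup S e ∧ (rank M (S [ e ]≔ false) <ᵇ rank M S)) (allFin n)

-- size-rank-coloop data as a multiset: multiplicity of each triple (a,b,c)
srcData : {n : ℕ} → Matroid n → ℕ × ℕ × ℕ → ℕ
srcData {n} M (a , b , c) =
  count (λ S → (∣ S ∣ ≡ᵇ a) ∧ (rank M S ≡ᵇ b) ∧ (coloops M S ≡ᵇ c)) (allSubsets n)

module Submission where

-- Rank sequences are read off permutations, so 𝒢(M) determines, for all j + t = a and b, the
-- number of permutations π whose prefixes satisfy r(π[1..a]) = b and r(π[1..j]) + t = b.  A chain
-- U ⊆ S with |U| = j and |S| = a is the pair (π[1..j], π[1..a]) for exactly j!(a−j)!(n−a)!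
-- permutations, so 𝒢(M) determines the number of such chains with r(S) = b and
-- r(U) + |S∖U| = r(S).  By submodularity, for U ⊆ S this equality holds exactly when every
-- element of S∖U is a coloop of M|S; hence these numbers are the binomial moments
-- Σ_{|S| = a, r(S) = b} (c(S) choose t), t ≤ a, which determine the multiset of the c(S).
-- Comparing the lengths of rank sequences first shows that both ground sets have the same size.

open import Defs
open import Data.Bool using (Bool; true; false; _∧_; _∨_; not; if_then_else_; T; T?)
open import Data.Bool.ListAction using (all; any; and)
open import Data.Bool.Properties using (∨-identityʳ; ∨-assoc; ∧-assoc; ∧-zeroʳ; ∧-identityʳ; T-≡; T-∧)
open import Data.Empty using (⊥-elim)
open import Data.Fin as Fin using (Fin; zero; suc)
open import Data.Fin.Subset using (Subset; Nonempty; ⊥; ⊤; ⁅_⁆; _∪_; _∩_; ∁; _∈_; _∉_; _⊆_; ∣_∣)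
open import Data.Fin.Subset.Properties
  using ( _∈?_; _⊆?_; nonempty?; drop-∷-⊆; ⊆-refl; ⊆-trans; ⊥⊆; p⊆p∪q; q⊆p∪q; p⊆q⇒∣p∣≤∣q∣; p⊆q⇒∁p⊇∁q
        ; ∪-identityʳ; ∩-identityʳ; ∩-assoc; ∩-comm; x∈p∩q⁺; x∈p∩q⁻; x∈p∪q⁻; x∉p⇒x∈∁p; x∈∁p⇒x∉p
        ; x∈⁅x⁆; x∈⁅y⁆⇒x≡y; x≢y⇒x∉⁅y⁆; Empty-unique; ∣⊥∣≡0; ∣⊤∣≡n; ∣p∣≤n; ∣p∣≡n⇒p≡⊤; ∣p∩q∣≤∣p∣)
open import Data.List using (List; []; _∷_; map; concatMap; concat; _++_; allFin; filterᵇ; take; length)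
import Data.List as List
open import Data.List.Properties using (map-cong; map-tabulate)
open import Data.List.Relation.Unary.All as All using (All; []; _∷_)
open import Data.List.Relation.Unary.All.Properties using (map⁺; all-filter)
open import Data.Nat using (ℕ; zero; suc; _+_; _*_; _∸_; _≤_; _<_; z≤n; s≤s; _≡ᵇ_; _<ᵇ_; _≟_; _≤?_; _!; NonZero)
open import Data.Nat.Combinatorics using (_C_; nCk+nC[k+1]≡[n+1]C[k+1]; nCn≡1; k>n⇒nCk≡0)
open import Data.Nat.ListAction using (sum)
open import Data.Nat.Properties
open import Algebra.Properties.CommutativeSemigroup +-commutativeSemigroup
  using () renaming (interchange to +-interchange; x∙yz≈y∙xz to +-x∙yz≈y∙xz; xy∙z≈y∙xz to +-xy∙z≈y∙xz)
open import Algebra.Properties.CommutativeSemigroup *-commutativeSemigroup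
  using () renaming (x∙yz≈y∙xz to *-x∙yz≈y∙xz)
open import Data.Nat.Solver using (module +-*-Solver)
open +-*-Solver using (solve; _:*_; _:=_)
open import Data.Product using (_×_; _,_; proj₁; proj₂)
open import Data.Sum using (inj₁; inj₂)
open import Data.Vec using (Vec; []; _∷_; here; there; lookup; toList; tabulate; _[_]≔_)
open import Data.Vec.Properties
  using (∷-injectiveʳ; lookup∘tabulate; lookup-replicate; lookup-zipWith; map-replicate; []=⇒lookup; lookup⇒[]=)
open import Function using (_∘_; id; _⇔_; mk⇔; Equivalence)
open import Relation.Binary.PropositionalEquality
open import Relation.Binary.PropositionalEquality using () renaming (trans to infixr 4 _∙_)
open import Relation.Nullary using (Dec; does; yes; no; ¬_; ¬?)
open import Relation.Nullary.Decidable using (dec-true; dec-false; does-⇔; ⌊_⌋; isYes≗does)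

private variable n k : ℕ

-- Indicators and finite sums

𝟙 : Bool → ℕ
𝟙 true = 1
𝟙 false = 0

χ : {P : Set} → Dec P → ℕ
χ d = 𝟙 (does d)

χ-yes : {P : Set} (d : Dec P) → P → χ d ≡ 1
χ-yes d p rewrite dec-true d p = refl

χ-no : {P : Set} (d : Dec P) → ¬ P → χ d ≡ 0
χ-no d ¬p rewrite dec-false d ¬p = refl

χ-guard : {P : Set} (d : Dec P) {x y : ℕ} → (P → x ≡ y) → χ d * x ≡ χ d * y
χ-guard (yes p) x≡y = cong (_+ 0) (x≡y p)
χ-guard (no _) _ = refl

χ-subst : (f : ℕ → ℕ) {a m : ℕ} (d : Dec (a ≡ m)) → f a * χ d ≡ f m * χ d
χ-subst f (yes refl) = refl
χ-subst f (no _) = *-zeroʳ (f _) ∙ sym (*-zeroʳ (f _))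

𝟙-∧ : (a b : Bool) → 𝟙 (a ∧ b) ≡ 𝟙 a * 𝟙 b
𝟙-∧ true b = sym (+-identityʳ (𝟙 b))
𝟙-∧ false b = refl

∑ : {A : Set} → List A → (A → ℕ) → ℕ
∑ [] f = 0
∑ (x ∷ xs) f = f x + ∑ xs f

infix 5 ∑
syntax ∑ xs (λ x → e) = ∑[ x ∈ xs ] e

module _ {A : Set} where

  ∑-cong : {f g : A → ℕ} (xs : List A) → (∀ x → f x ≡ g x) → ∑ xs f ≡ ∑ xs g
  ∑-cong [] f≗g = refl
  ∑-cong (x ∷ xs) f≗g = cong₂ _+_ (f≗g x) (∑-cong xs f≗g)

  ∑-zero : {f : A → ℕ} (xs : List A) → (∀ x → f x ≡ 0) → ∑ xs f ≡ 0
  ∑-zero [] f≗0 = refl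
  ∑-zero (x ∷ xs) f≗0 rewrite f≗0 x = ∑-zero xs f≗0

  ∑-++ : (f : A → ℕ) (xs ys : List A) → ∑ (xs ++ ys) f ≡ ∑ xs f + ∑ ys f
  ∑-++ f [] ys = refl
  ∑-++ f (x ∷ xs) ys = cong (f x +_) (∑-++ f xs ys) ∙ sym (+-assoc (f x) _ _)

  ∑-+ : (f g : A → ℕ) (xs : List A) → ∑[ x ∈ xs ] (f x + g x) ≡ ∑ xs f + ∑ xs g
  ∑-+ f g [] = refl
  ∑-+ f g (x ∷ xs) = cong (f x + g x +_) (∑-+ f g xs) ∙ +-interchange (f x) (g x) _ _

  ∑-*ˡ : (c : ℕ) (f : A → ℕ) (xs : List A) → ∑[ x ∈ xs ] c * f x ≡ c * ∑ xs f
  ∑-*ˡ c f [] = sym (*-zeroʳ c)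
  ∑-*ˡ c f (x ∷ xs) = cong (c * f x +_) (∑-*ˡ c f xs) ∙ sym (*-distribˡ-+ c (f x) _)

  ∑-*ʳ : (c : ℕ) (f : A → ℕ) (xs : List A) → ∑[ x ∈ xs ] f x * c ≡ ∑ xs f * c
  ∑-*ʳ c f xs = ∑-cong xs (λ x → *-comm (f x) c) ∙ ∑-*ˡ c f xs ∙ *-comm c _

  count≡∑ : (p : A → Bool) (xs : List A) → count p xs ≡ ∑[ x ∈ xs ] 𝟙 (p x)
  count≡∑ p [] = refl
  count≡∑ p (x ∷ xs) with p x
  ... | true = cong suc (count≡∑ p xs)
  ... | false = count≡∑ p xs

  count-∷ : (q : A → Bool) (x : A) (xs : List A) → count q (x ∷ xs) ≡ 𝟙 (q x) + count q xs
  count-∷ q x xs with q x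
  ... | true = refl
  ... | false = refl

  count-cong : {p q : A → Bool} (xs : List A) → (∀ x → p x ≡ q x) → count p xs ≡ count q xs
  count-cong {p} {q} xs p≗q = count≡∑ p xs ∙ ∑-cong xs (cong 𝟙 ∘ p≗q) ∙ sym (count≡∑ q xs)

module _ {A B : Set} where

  ∑-map : (f : B → ℕ) (g : A → B) (xs : List A) → ∑ (map g xs) f ≡ ∑[ x ∈ xs ] f (g x)
  ∑-map f g [] = refl
  ∑-map f g (x ∷ xs) = cong (f (g x) +_) (∑-map f g xs)

  ∑-concatMap : (f : B → ℕ) (g : A → List B) (xs : List A) → ∑ (concatMap g xs) f ≡ ∑[ x ∈ xs ] ∑ (g x) f
  ∑-concatMap f g [] = refl
  ∑-concatMap f g (x ∷ xs) = ∑-++ f (g x) (concat (map g xs)) ∙ cong (∑ (g x) f +_) (∑-concatMap f g xs)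

  ∑-comm : (f : A → B → ℕ) (xs : List A) (ys : List B) →
    ∑[ x ∈ xs ] ∑[ y ∈ ys ] f x y ≡ ∑[ y ∈ ys ] ∑[ x ∈ xs ] f x y
  ∑-comm f [] ys = sym (∑-zero ys (λ _ → refl))
  ∑-comm f (x ∷ xs) ys = cong (∑ ys (f x) +_) (∑-comm f xs ys) ∙ sym (∑-+ (f x) (λ y → ∑[ x ∈ xs ] f x y) ys)

  ∑-filterᵇ-map : (p : A → Bool) (g : A → B) (f : B → ℕ) (xs : List A) →
    ∑[ x ∈ xs ] 𝟙 (p x) * f (g x) ≡ ∑ (map g (filterᵇ p xs)) f
  ∑-filterᵇ-map p g f [] = refl
  ∑-filterᵇ-map p g f (x ∷ xs) with p x
  ... | true = cong₂ _+_ (+-identityʳ (f (g x))) (∑-filterᵇ-map p g f xs)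
  ... | false = ∑-filterᵇ-map p g f xs

  count-∧-map : (p : A → Bool) (q : B → Bool) (g : A → B) (xs : List A) →
    count (λ x → p x ∧ q (g x)) xs ≡ count q (map g (filterᵇ p xs))
  count-∧-map p q g [] = refl
  count-∧-map p q g (x ∷ xs) with p x
  ... | false = count-∧-map p q g xs
  ... | true with q (g x)
  ...   | true = cong suc (count-∧-map p q g xs)
  ...   | false = count-∧-map p q g xs

∑-tabulate : {A : Set} (f : A → ℕ) (g : Fin n → A) → ∑ (List.tabulate g) f ≡ ∑[ i ∈ allFin n ] f (g i)
∑-tabulate {zero} f g = refl
∑-tabulate {suc n} f g = cong (f (g zero) +_) (∑-tabulate f (g ∘ suc) ∙ sym (∑-tabulate (f ∘ g) suc))

∑-allFin-suc : (f : Fin (suc n) → ℕ) → ∑ (allFin (suc n)) f ≡ f zero + (∑[ i ∈ allFin n ] f (suc i))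
∑-allFin-suc f = cong (f zero +_) (∑-tabulate f suc)

∑-allVecs-suc : {A : Set} (f : Vec A (suc k) → ℕ) (xs : List A) →
  ∑ (allVecs xs (suc k)) f ≡ ∑[ x ∈ xs ] ∑[ w ∈ allVecs xs k ] f (x ∷ w)
∑-allVecs-suc {k} f xs =
  ∑-concatMap f (λ x → map (x ∷_) (allVecs xs k)) xs ∙ ∑-cong xs (λ x → ∑-map f (x ∷_) (allVecs xs k))

∑-allSubsets-suc : (f : Subset (suc n) → ℕ) →
  ∑ (allSubsets (suc n)) f ≡ (∑[ U ∈ allSubsets n ] f (true ∷ U)) + (∑[ U ∈ allSubsets n ] f (false ∷ U))
∑-allSubsets-suc {n} f = ∑-allVecs-suc f _ ∙ cong ((∑[ U ∈ allSubsets n ] f (true ∷ U)) +_) (+-identityʳ _)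

∑-allSubsets-point : (A : Subset n) (F : Subset n → ℕ) → (∀ U → U ≢ A → F U ≡ 0) → ∑ (allSubsets n) F ≡ F A
∑-allSubsets-point [] F F-off = +-identityʳ (F [])
∑-allSubsets-point {suc n} (true ∷ A) F F-off =
  ∑-allSubsets-suc F
  ∙ cong₂ _+_ (∑-allSubsets-point A (F ∘ (true ∷_)) (λ U U≢A → F-off _ (U≢A ∘ ∷-injectiveʳ)))
              (∑-zero (allSubsets n) (λ U → F-off (false ∷ U) λ ()))
  ∙ +-identityʳ _
∑-allSubsets-point {suc n} (false ∷ A) F F-off =
  ∑-allSubsets-suc F
  ∙ cong₂ _+_ (∑-zero (allSubsets n) (λ U → F-off (true ∷ U) λ ()))
              (∑-allSubsets-point A (F ∘ (false ∷_)) (λ U U≢A → F-off _ (U≢A ∘ ∷-injectiveʳ)))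

-- Multisets and binomial moments

module _ {A : Set} (_==_ : A → A → Bool) (==-refl : ∀ x → (x == x) ≡ true)
         (==-sound : ∀ x y → (x == y) ≡ true → x ≡ y) where

  private
    remove : A → List A → List A
    remove s [] = []
    remove s (y ∷ ys) = if y == s then ys else y ∷ remove s ys

    count-remove : ∀ s ys → 0 < count (_== s) ys → (q : A → Bool) → count q ys ≡ 𝟙 (q s) + count q (remove s ys)
    count-remove s (y ∷ ys) s∈ys q with y == s in y==s
    ... | true = count-∷ q y ys ∙ cong (λ z → 𝟙 (q z) + count q ys) (==-sound y s y==s)
    ... | false = count-∷ q y ys ∙ cong (𝟙 (q y) +_) (count-remove s ys s∈ys q)
                  ∙ +-x∙yz≈y∙xz (𝟙 (q y)) (𝟙 (q s)) _ ∙ cong (𝟙 (q s) +_) (sym (count-∷ q y (remove s ys)))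

  same-multiplicities⇒same-counts : (xs ys : List A) → (∀ s → count (_== s) xs ≡ count (_== s) ys) →
    ∀ q → count q xs ≡ count q ys
  same-multiplicities⇒same-counts [] [] same q = refl
  same-multiplicities⇒same-counts [] (y ∷ ys) same q =
    ⊥-elim (0≢1+n (same y ∙ count-∷ (_== y) y ys ∙ cong (λ b → 𝟙 b + count (_== y) ys) (==-refl y)))
  same-multiplicities⇒same-counts (x ∷ xs) ys same q =
    count-∷ q x xs ∙ cong (𝟙 (q x) +_) (same-multiplicities⇒same-counts xs (remove x ys) same′ q)
    ∙ sym (count-remove x ys x∈ys q)
    where
    x∈ys : 0 < count (_== x) ys
    x∈ys = subst (0 <_) (sym (count-∷ (_== x) x xs ∙ cong (λ b → 𝟙 b + count (_== x) xs) (==-refl x)) ∙ same x)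
                 (s≤s z≤n)
    same′ : ∀ s → count (_== s) xs ≡ count (_== s) (remove x ys)
    same′ s = +-cancelˡ-≡ (𝟙 (x == s)) _ _ (sym (count-∷ (_== s) x xs) ∙ same s ∙ count-remove x ys x∈ys (_== s))

dropValue : ℕ → List ℕ → List ℕ
dropValue B = filterᵇ (λ x → not (x ≡ᵇ B))

∑-dropValue : (B : ℕ) (f : ℕ → ℕ) (xs : List ℕ) → ∑ xs f ≡ ∑ (dropValue B xs) f + count (_≡ᵇ B) xs * f B
∑-dropValue B f [] = refl
∑-dropValue B f (x ∷ xs) with x ≡ᵇ B in x≡ᵇB
... | false = cong (f x +_) (∑-dropValue B f xs) ∙ sym (+-assoc (f x) _ _)
... | true rewrite ≡ᵇ⇒≡ x B (Equivalence.from T-≡ x≡ᵇB) =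
  cong (f B +_) (∑-dropValue B f xs) ∙ +-x∙yz≈y∙xz (f B) (∑ (dropValue B xs) f) (count (_≡ᵇ B) xs * f B)

count-dropValue : (B : ℕ) (q : ℕ → Bool) (xs : List ℕ) →
  count q xs ≡ count q (dropValue B xs) + count (_≡ᵇ B) xs * 𝟙 (q B)
count-dropValue B q xs =
  count≡∑ q xs ∙ ∑-dropValue B (𝟙 ∘ q) xs ∙ cong (_+ count (_≡ᵇ B) xs * 𝟙 (q B)) (sym (count≡∑ q (dropValue B xs)))

dropValue-< : {B : ℕ} {xs : List ℕ} → All (_< suc B) xs → All (_< B) (dropValue B xs)
dropValue-< [] = []
dropValue-< {B} {x ∷ xs} (x<1+B ∷ xs<1+B) with x ≡ᵇ B in x≡ᵇB
... | true = dropValue-< xs<1+B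
... | false = ≤∧≢⇒< (≤-pred x<1+B) (λ x≡B → subst T x≡ᵇB (≡⇒≡ᵇ x B x≡B)) ∷ dropValue-< xs<1+B

∑-cong-All : {P : ℕ → Set} {f g : ℕ → ℕ} {xs : List ℕ} → All P xs → (∀ {x} → P x → f x ≡ g x) → ∑ xs f ≡ ∑ xs g
∑-cong-All [] f≗g = refl
∑-cong-All (px ∷ pxs) f≗g = cong₂ _+_ (f≗g px) (∑-cong-All pxs f≗g)

x≤B⇒xCB≡χ : {x B : ℕ} → x ≤ B → (x≟B : Dec (x ≡ B)) → x C B ≡ χ x≟B
x≤B⇒xCB≡χ {x} _ (yes refl) = nCn≡1 x
x≤B⇒xCB≡χ x≤B (no x≢B) = k>n⇒nCk≡0 (≤∧≢⇒< x≤B x≢B)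

-- Induction on the bound: since x C B ≡ [x ≡ B] for x ≤ B, the multiplicity of the largest
-- possible value is its binomial moment, and it can then be removed from both lists.
binomial-moments⇒multiplicities : (B : ℕ) {xs ys : List ℕ} → All (_< B) xs → All (_< B) ys →
  (∀ t → t < B → ∑[ x ∈ xs ] x C t ≡ ∑[ y ∈ ys ] y C t) → ∀ c → count (_≡ᵇ c) xs ≡ count (_≡ᵇ c) ys
binomial-moments⇒multiplicities zero [] [] _ c = refl
binomial-moments⇒multiplicities (suc B) {xs} {ys} xs<1+B ys<1+B same c =
  count-dropValue B (_≡ᵇ c) xs
  ∙ cong₂ (λ u v → u + v * 𝟙 (B ≡ᵇ c))
          (binomial-moments⇒multiplicities B (dropValue-< xs<1+B) (dropValue-< ys<1+B) same-below c) same-top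
  ∙ sym (count-dropValue B (_≡ᵇ c) ys)
  where
  top : {zs : List ℕ} → All (_< suc B) zs → count (_≡ᵇ B) zs ≡ ∑[ z ∈ zs ] z C B
  top {zs} zs<1+B = count≡∑ _ zs ∙ ∑-cong-All zs<1+B (λ {z} z<1+B → sym (x≤B⇒xCB≡χ (≤-pred z<1+B) (z ≟ B)))
  same-top : count (_≡ᵇ B) xs ≡ count (_≡ᵇ B) ys
  same-top = top xs<1+B ∙ same B ≤-refl ∙ sym (top ys<1+B)
  same-below : ∀ t → t < B → ∑[ x ∈ dropValue B xs ] x C t ≡ ∑[ y ∈ dropValue B ys ] y C t
  same-below t t<B = +-cancelʳ-≡ _ _ _
    (sym (∑-dropValue B (_C t) xs) ∙ same t (m<n⇒m<1+n t<B) ∙ ∑-dropValue B (_C t) ys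
     ∙ cong (λ m → ∑ (dropValue B ys) (_C t) + m * (B C t)) (sym same-top))

-- Subsets

-- Defined through _∩_ and ∁ rather than the library's _─_, whose where-bound helper keeps
-- (s ∷ S) ─ (u ∷ U) from computing to a cons cell.
infixl 5 _∖_
_∖_ : Subset n → Subset n → Subset n
S ∖ U = S ∩ ∁ U

∁⊥≡⊤ : ∁ (⊥ {n}) ≡ ⊤
∁⊥≡⊤ {n} = map-replicate not false n

∖-comm : (S X Y : Subset n) → S ∖ X ∖ Y ≡ S ∖ Y ∖ X
∖-comm S X Y = ∩-assoc S (∁ X) (∁ Y) ∙ cong (S ∩_) (∩-comm (∁ X) (∁ Y)) ∙ sym (∩-assoc S (∁ Y) (∁ X))

X∖⁅x⁆≡X[x]≔false : (X : Subset n) (x : Fin n) → X ∖ ⁅ x ⁆ ≡ X [ x ]≔ false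
X∖⁅x⁆≡X[x]≔false (b ∷ X) zero = cong₂ _∷_ (∧-zeroʳ b) (cong (X ∩_) ∁⊥≡⊤ ∙ ∩-identityʳ X)
X∖⁅x⁆≡X[x]≔false (b ∷ X) (suc x) = cong₂ _∷_ (∧-identityʳ b) (X∖⁅x⁆≡X[x]≔false X x)

S⊆U∪[S∖U] : (U S : Subset n) → S ⊆ U ∪ (S ∖ U)
S⊆U∪[S∖U] U S {x} x∈S with x ∈? U
... | yes x∈U = p⊆p∪q (S ∖ U) x∈U
... | no x∉U = q⊆p∪q U (S ∖ U) (x∈p∩q⁺ (x∈S , x∉p⇒x∈∁p x∉U))

x∈A⇒A∪⁅x⁆≡A : {x : Fin n} {A : Subset n} → x ∈ A → A ∪ ⁅ x ⁆ ≡ A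
x∈A⇒A∪⁅x⁆≡A {A = true ∷ A} here = cong (true ∷_) (∪-identityʳ A)
x∈A⇒A∪⁅x⁆≡A {A = a ∷ A} (there x∈A) = cong₂ _∷_ (∨-identityʳ a) (x∈A⇒A∪⁅x⁆≡A x∈A)

x∉A⇒∣A∪⁅x⁆∣≡1+∣A∣ : {x : Fin n} {A : Subset n} → x ∉ A → ∣ A ∪ ⁅ x ⁆ ∣ ≡ suc ∣ A ∣
x∉A⇒∣A∪⁅x⁆∣≡1+∣A∣ {x = zero} {true ∷ A} x∉A = ⊥-elim (x∉A here)
x∉A⇒∣A∪⁅x⁆∣≡1+∣A∣ {x = zero} {false ∷ A} x∉A = cong (suc ∘ ∣_∣) (∪-identityʳ A)
x∉A⇒∣A∪⁅x⁆∣≡1+∣A∣ {x = suc x} {true ∷ A} x∉A = cong suc (x∉A⇒∣A∪⁅x⁆∣≡1+∣A∣ (x∉A ∘ there))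
x∉A⇒∣A∪⁅x⁆∣≡1+∣A∣ {x = suc x} {false ∷ A} x∉A = x∉A⇒∣A∪⁅x⁆∣≡1+∣A∣ (x∉A ∘ there)

x∉A⇒∣A∪⁅x⁆∣+k≡∣A∣+1+k : {x : Fin n} {A : Subset n} → x ∉ A → ∣ A ∪ ⁅ x ⁆ ∣ + k ≡ ∣ A ∣ + suc k
x∉A⇒∣A∪⁅x⁆∣+k≡∣A∣+1+k {k = k} {A = A} x∉A = cong (_+ k) (x∉A⇒∣A∪⁅x⁆∣≡1+∣A∣ x∉A) ∙ sym (+-suc ∣ A ∣ k)

∣A∪⁅x⁆∣≤1+∣A∣ : (A : Subset n) (x : Fin n) → ∣ A ∪ ⁅ x ⁆ ∣ ≤ suc ∣ A ∣
∣A∪⁅x⁆∣≤1+∣A∣ A x with x ∈? A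
... | yes x∈A = ≤-trans (≤-reflexive (cong ∣_∣ (x∈A⇒A∪⁅x⁆≡A x∈A))) (n≤1+n _)
... | no x∉A = ≤-reflexive (x∉A⇒∣A∪⁅x⁆∣≡1+∣A∣ x∉A)

x∈X⇒∣X∣≡1+∣X∖⁅x⁆∣ : {x : Fin n} {X : Subset n} → x ∈ X → ∣ X ∣ ≡ suc ∣ X ∖ ⁅ x ⁆ ∣
x∈X⇒∣X∣≡1+∣X∖⁅x⁆∣ {X = true ∷ X} here = cong (suc ∘ ∣_∣) (sym (cong (X ∩_) ∁⊥≡⊤ ∙ ∩-identityʳ X))
x∈X⇒∣X∣≡1+∣X∖⁅x⁆∣ {X = true ∷ X} (there x∈X) = cong suc (x∈X⇒∣X∣≡1+∣X∖⁅x⁆∣ x∈X)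
x∈X⇒∣X∣≡1+∣X∖⁅x⁆∣ {X = false ∷ X} (there x∈X) = x∈X⇒∣X∣≡1+∣X∖⁅x⁆∣ x∈X

U⊆S⇒∣S∣≡∣U∣+∣S∖U∣ : {U S : Subset n} → U ⊆ S → ∣ S ∣ ≡ ∣ U ∣ + ∣ S ∖ U ∣
U⊆S⇒∣S∣≡∣U∣+∣S∖U∣ {U = []} {[]} U⊆S = refl
U⊆S⇒∣S∣≡∣U∣+∣S∖U∣ {U = true ∷ U} {true ∷ S} U⊆S = cong suc (U⊆S⇒∣S∣≡∣U∣+∣S∖U∣ (drop-∷-⊆ U⊆S))
U⊆S⇒∣S∣≡∣U∣+∣S∖U∣ {U = true ∷ U} {false ∷ S} U⊆S with U⊆S here
... | ()
U⊆S⇒∣S∣≡∣U∣+∣S∖U∣ {U = false ∷ U} {true ∷ S} U⊆S =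
  cong suc (U⊆S⇒∣S∣≡∣U∣+∣S∖U∣ (drop-∷-⊆ U⊆S)) ∙ sym (+-suc ∣ U ∣ _)
U⊆S⇒∣S∣≡∣U∣+∣S∖U∣ {U = false ∷ U} {false ∷ S} U⊆S = U⊆S⇒∣S∣≡∣U∣+∣S∖U∣ (drop-∷-⊆ U⊆S)

⊆∧∣∣≤⇒≡ : {A U : Subset n} → A ⊆ U → ∣ U ∣ ≤ ∣ A ∣ → A ≡ U
⊆∧∣∣≤⇒≡ {A = []} {[]} A⊆U size = refl
⊆∧∣∣≤⇒≡ {A = true ∷ A} {true ∷ U} A⊆U (s≤s size) = cong (true ∷_) (⊆∧∣∣≤⇒≡ (drop-∷-⊆ A⊆U) size)
⊆∧∣∣≤⇒≡ {A = false ∷ A} {false ∷ U} A⊆U size = cong (false ∷_) (⊆∧∣∣≤⇒≡ (drop-∷-⊆ A⊆U) size)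
⊆∧∣∣≤⇒≡ {A = true ∷ A} {false ∷ U} A⊆U size with A⊆U here
... | ()
⊆∧∣∣≤⇒≡ {A = false ∷ A} {true ∷ U} A⊆U size = ⊥-elim (n≮n ∣ U ∣ (≤-trans size (p⊆q⇒∣p∣≤∣q∣ (drop-∷-⊆ A⊆U))))

∣X∣≡∑ : (X : Subset n) → ∣ X ∣ ≡ ∑[ e ∈ allFin n ] 𝟙 (lookup X e)
∣X∣≡∑ [] = refl
∣X∣≡∑ (true ∷ X) = cong suc (∣X∣≡∑ X) ∙ sym (∑-allFin-suc (𝟙 ∘ lookup (true ∷ X)))
∣X∣≡∑ (false ∷ X) = ∣X∣≡∑ X ∙ sym (∑-allFin-suc (𝟙 ∘ lookup (false ∷ X)))

∣X∣≡1+d⇒Nonempty : {X : Subset n} {d : ℕ} → ∣ X ∣ ≡ suc d → Nonempty X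
∣X∣≡1+d⇒Nonempty {n} {X} size with nonempty? X
... | yes nonempty = nonempty
... | no empty = ⊥-elim (0≢1+n (sym (∣⊥∣≡0 n) ∙ cong ∣_∣ (sym (Empty-unique empty)) ∙ size))

∑∉ : Subset n → (Fin n → ℕ) → ℕ
∑∉ A f = ∑[ x ∈ allFin _ ] χ (¬? (x ∈? A)) * f x

infix 5 ∑∉
syntax ∑∉ A (λ x → e) = ∑[ x ∉ A ] e

∑∉-cong : (A : Subset n) {f g : Fin n → ℕ} → (∀ x → x ∉ A → f x ≡ g x) → ∑∉ A f ≡ ∑∉ A g
∑∉-cong A f≗g = ∑-cong (allFin _) λ x → pointwise x (x ∈? A)
  where
  pointwise : ∀ x (x∈?A : Dec (x ∈ A)) → χ (¬? x∈?A) * _ ≡ χ (¬? x∈?A) * _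
  pointwise x (yes _) = refl
  pointwise x (no x∉A) = cong (_+ 0) (f≗g x x∉A)

∑∉-*ˡ : (A : Subset n) (c : ℕ) (f : Fin n → ℕ) → ∑[ x ∉ A ] c * f x ≡ c * ∑∉ A f
∑∉-*ˡ {n} A c f = ∑-cong (allFin n) (λ x → *-x∙yz≈y∙xz (χ (¬? (x ∈? A))) c (f x))
              ∙ ∑-*ˡ c (λ x → χ (¬? (x ∈? A)) * f x) (allFin n)

∑∉-const : (A : Subset n) (c : ℕ) → ∑[ x ∉ A ] c ≡ (n ∸ ∣ A ∣) * c
∑∉-const [] c = refl
∑∉-const (true ∷ A) c = ∑-allFin-suc (λ x → χ (¬? (x ∈? true ∷ A)) * c) ∙ ∑∉-const A c
∑∉-const (false ∷ A) c =
  ∑-allFin-suc (λ x → χ (¬? (x ∈? false ∷ A)) * c) ∙ cong₂ _+_ (+-identityʳ c) (∑∉-const A c)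
  ∙ cong (_* c) (sym (+-∸-assoc 1 (∣p∣≤n A)))

sumSupersets : Subset n → ℕ → (Subset n → ℕ) → ℕ
sumSupersets A m F = ∑[ U ∈ allSubsets _ ] χ (A ⊆? U) * (χ (∣ U ∣ ≟ m) * F U)

sumSupersets-self : (A : Subset n) {m : ℕ} (F : Subset n → ℕ) → m ≡ ∣ A ∣ → sumSupersets A m F ≡ F A
sumSupersets-self A F refl = ∑-allSubsets-point A _ vanish ∙ at-A
  where
  vanish : ∀ U → U ≢ A → χ (A ⊆? U) * (χ (∣ U ∣ ≟ ∣ A ∣) * F U) ≡ 0
  vanish U U≢A with A ⊆? U
  ... | no _ = refl
  ... | yes A⊆U = *-identityˡ _ ∙ cong (_* F U)
                    (χ-no (∣ U ∣ ≟ ∣ A ∣) (λ same → U≢A (sym (⊆∧∣∣≤⇒≡ A⊆U (≤-reflexive same)))))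
  at-A : χ (A ⊆? A) * (χ (∣ A ∣ ≟ ∣ A ∣) * F A) ≡ F A
  at-A = cong₂ (λ a b → a * (b * F A)) (χ-yes (A ⊆? A) ⊆-refl) (χ-yes (∣ A ∣ ≟ ∣ A ∣) refl)
         ∙ *-identityˡ _ ∙ *-identityˡ _

extends : Subset n → Subset n → Fin n → ℕ
extends A U x = χ (¬? (x ∈? A)) * χ (A ∪ ⁅ x ⁆ ⊆? U)

∑-extends : (A U : Subset n) → ∑ (allFin n) (extends A U) ≡ χ (A ⊆? U) * (∣ U ∣ ∸ ∣ A ∣)
∑-extends [] [] = refl
∑-extends (true ∷ A) (true ∷ U) = ∑-allFin-suc (extends (true ∷ A) (true ∷ U)) ∙ ∑-extends A U
∑-extends (true ∷ A) (false ∷ U) =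
  ∑-allFin-suc (extends (true ∷ A) (false ∷ U)) ∙ ∑-zero (allFin _) (λ x → *-zeroʳ (χ (¬? (x ∈? A))))
∑-extends (false ∷ A) (false ∷ U) = ∑-allFin-suc (extends (false ∷ A) (false ∷ U)) ∙ ∑-extends A U
∑-extends (false ∷ A) (true ∷ U) =
  ∑-allFin-suc (extends (false ∷ A) (true ∷ U))
  ∙ cong₂ _+_ (cong (λ B → χ (B ⊆? U) + 0) (∪-identityʳ A)) (∑-extends A U) ∙ add-head
  where
  add-head : χ (A ⊆? U) + 0 + χ (A ⊆? U) * (∣ U ∣ ∸ ∣ A ∣) ≡ χ (A ⊆? U) * (suc ∣ U ∣ ∸ ∣ A ∣)
  add-head with A ⊆? U
  ... | no _ = refl
  ... | yes A⊆U = cong suc (*-identityˡ _) ∙ sym (*-identityˡ _ ∙ +-∸-assoc 1 (p⊆q⇒∣p∣≤∣q∣ A⊆U))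

-- Double counting the pairs (x, U) with x ∉ A and A ∪ ⁅ x ⁆ ⊆ U.
∑∉-sumSupersets : (A : Subset n) (m : ℕ) (F : Subset n → ℕ) →
  ∑[ x ∉ A ] sumSupersets (A ∪ ⁅ x ⁆) m F ≡ (m ∸ ∣ A ∣) * sumSupersets A m F
∑∉-sumSupersets {n} A m F = begin
  ∑[ x ∉ A ] sumSupersets (A ∪ ⁅ x ⁆) m F
    ≡⟨ ∑-cong (allFin n) (λ x → sym (∑-*ˡ (χ (¬? (x ∈? A))) (λ U → χ (A ∪ ⁅ x ⁆ ⊆? U) * g U) (allSubsets n))
                                 ∙ ∑-cong (allSubsets n) (λ U → sym (*-assoc (χ (¬? (x ∈? A))) _ (g U)))) ⟩
  ∑[ x ∈ allFin n ] ∑[ U ∈ allSubsets n ] extends A U x * g U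
    ≡⟨ ∑-comm (λ x U → extends A U x * g U) (allFin n) (allSubsets n) ⟩
  ∑[ U ∈ allSubsets n ] ∑[ x ∈ allFin n ] extends A U x * g U
    ≡⟨ ∑-cong (allSubsets n) (λ U → ∑-*ʳ (g U) (extends A U) (allFin n) ∙ cong (_* g U) (∑-extends A U)) ⟩
  ∑[ U ∈ allSubsets n ] χ (A ⊆? U) * (∣ U ∣ ∸ ∣ A ∣) * g U
    ≡⟨ ∑-cong (allSubsets n) size-is-m ⟩
  ∑[ U ∈ allSubsets n ] (m ∸ ∣ A ∣) * (χ (A ⊆? U) * g U)
    ≡⟨ ∑-*ˡ (m ∸ ∣ A ∣) _ (allSubsets n) ⟩
  (m ∸ ∣ A ∣) * sumSupersets A m F ∎
  where
  open ≡-Reasoning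
  g : Subset n → ℕ
  g U = χ (∣ U ∣ ≟ m) * F U
  rearrange : ∀ a b c d → a * b * (c * d) ≡ a * d * (b * c)
  rearrange = solve 4 (λ a b c d → a :* b :* (c :* d) := a :* d :* (b :* c)) refl
  rearrange′ : ∀ a e c d → a * d * (e * c) ≡ e * (a * (c * d))
  rearrange′ = solve 4 (λ a e c d → a :* d :* (e :* c) := e :* (a :* (c :* d))) refl
  size-is-m : ∀ U → χ (A ⊆? U) * (∣ U ∣ ∸ ∣ A ∣) * g U ≡ (m ∸ ∣ A ∣) * (χ (A ⊆? U) * g U)
  size-is-m U = rearrange (χ (A ⊆? U)) (∣ U ∣ ∸ ∣ A ∣) (χ (∣ U ∣ ≟ m)) (F U)
                ∙ cong (χ (A ⊆? U) * F U *_) (χ-subst (_∸ ∣ A ∣) (∣ U ∣ ≟ m))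
                ∙ rearrange′ (χ (A ⊆? U)) (m ∸ ∣ A ∣) (χ (∣ U ∣ ≟ m)) (F U)

removal : Subset n → Subset n → ℕ → Subset n → ℕ
removal S X t U = χ (U ⊆? S) * (χ (S ∖ U ⊆? X) * χ (∣ S ∖ U ∣ ≟ t))

∑-removal : (S X : Subset n) (t : ℕ) → ∑ (allSubsets n) (removal S X t) ≡ ∣ S ∩ X ∣ C t
∑-removal [] [] zero = refl
∑-removal [] [] (suc t) = refl
∑-removal {suc n} (true ∷ S) (true ∷ X) zero =
  ∑-allSubsets-suc (removal (true ∷ S) (true ∷ X) zero)
  ∙ cong₂ _+_ (∑-removal S X zero)
              (∑-zero (allSubsets n) (λ U → cong (χ (U ⊆? S) *_) (*-zeroʳ (χ (S ∖ U ⊆? X))) ∙ *-zeroʳ (χ (U ⊆? S))))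
  ∙ +-identityʳ _
∑-removal (true ∷ S) (true ∷ X) (suc t) =
  ∑-allSubsets-suc (removal (true ∷ S) (true ∷ X) (suc t))
  ∙ cong₂ _+_ (∑-removal S X (suc t)) (∑-removal S X t)
  ∙ +-comm (∣ S ∩ X ∣ C suc t) _ ∙ nCk+nC[k+1]≡[n+1]C[k+1] ∣ S ∩ X ∣ t
∑-removal {suc n} (true ∷ S) (false ∷ X) t =
  ∑-allSubsets-suc (removal (true ∷ S) (false ∷ X) t)
  ∙ cong₂ _+_ (∑-removal S X t) (∑-zero (allSubsets n) (λ U → *-zeroʳ (χ (U ⊆? S))))
  ∙ +-identityʳ _
∑-removal {suc n} (false ∷ S) (c ∷ X) t =
  ∑-allSubsets-suc (removal (false ∷ S) (c ∷ X) t)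
  ∙ cong₂ _+_ (∑-zero (allSubsets n) (λ _ → refl)) (∑-removal S X t)

-- Sequences completing a subset

occurs : Fin n → Vec (Fin n) k → Bool
occurs j v = any (λ x → ⌊ j Fin.≟ x ⌋) (toList v)

covers : Subset n → Vec (Fin n) k → Bool
covers A v = all (λ j → lookup A j ∨ occurs j v) (allFin _)

all-cong : {A : Set} {p q : A → Bool} (xs : List A) → (∀ x → p x ≡ q x) → all p xs ≡ all q xs
all-cong xs p≗q = cong and (map-cong p≗q xs)

isBijection≡covers⊥ : (π : Vec (Fin n) n) → isBijection π ≡ covers ⊥ π
isBijection≡covers⊥ π = all-cong (allFin _) (λ j → sym (cong (_∨ occurs j π) (lookup-replicate j false)))

lookup-⁅⁆ : (x j : Fin n) → lookup ⁅ x ⁆ j ≡ does (j Fin.≟ x)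
lookup-⁅⁆ zero zero = refl
lookup-⁅⁆ zero (suc j) = lookup-replicate j false
lookup-⁅⁆ (suc x) zero = refl
lookup-⁅⁆ (suc x) (suc j) = lookup-⁅⁆ x j

covers-∷ : (A : Subset n) (x : Fin n) (v : Vec (Fin n) k) → covers A (x ∷ v) ≡ covers (A ∪ ⁅ x ⁆) v
covers-∷ A x v = all-cong (allFin _) λ j → begin
  lookup A j ∨ ⌊ j Fin.≟ x ⌋ ∨ occurs j v        ≡⟨ sym (∨-assoc (lookup A j) _ _) ⟩
  (lookup A j ∨ ⌊ j Fin.≟ x ⌋) ∨ occurs j v      ≡⟨ cong (λ b → (lookup A j ∨ b) ∨ occurs j v)
                                                   (isYes≗does (j Fin.≟ x) ∙ sym (lookup-⁅⁆ x j)) ⟩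
  (lookup A j ∨ lookup ⁅ x ⁆ j) ∨ occurs j v   ≡⟨ cong (_∨ occurs j v) (sym (lookup-zipWith _∨_ j A ⁅ x ⁆)) ⟩
  lookup (A ∪ ⁅ x ⁆) j ∨ occurs j v ∎
  where open ≡-Reasoning

covers-[]⇒≡⊤ : (A : Subset n) → covers A [] ≡ true → A ≡ ⊤
covers-[]⇒≡⊤ [] _ = refl
covers-[]⇒≡⊤ (true ∷ A) covered = cong (true ∷_) (covers-[]⇒≡⊤ A (subst (_≡ true) shift covered))
  where
  shift : and (map (λ j → lookup (true ∷ A) j ∨ false) (List.tabulate Fin.suc)) ≡ covers A []
  shift = cong and (map-tabulate Fin.suc _ ∙ sym (map-tabulate id (λ j → lookup A j ∨ false)))

∣A∣≡n⇒covers-[] : (A : Subset n) → ∣ A ∣ ≡ n → covers A [] ≡ true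
∣A∣≡n⇒covers-[] {n} A full =
  cong (λ B → covers B []) (∣p∣≡n⇒p≡⊤ {p = A} full)
  ∙ all-cong (allFin n) (λ j → cong (_∨ false) (lookup-replicate j true)) ∙ all-true (allFin n)
  where
  all-true : (xs : List (Fin n)) → all (λ _ → true) xs ≡ true
  all-true [] = refl
  all-true (_ ∷ xs) = all-true xs

covers⇒n≤∣A∣+k : (A : Subset n) (v : Vec (Fin n) k) → covers A v ≡ true → n ≤ ∣ A ∣ + k
covers⇒n≤∣A∣+k {n} A [] covered =
  ≤-reflexive (sym (cong ∣_∣ (covers-[]⇒≡⊤ A covered) ∙ ∣⊤∣≡n n) ∙ sym (+-identityʳ _))
covers⇒n≤∣A∣+k {k = suc k} A (x ∷ v) covered =
  ≤-trans (covers⇒n≤∣A∣+k (A ∪ ⁅ x ⁆) v (sym (covers-∷ A x v) ∙ covered))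
          (≤-trans (+-monoˡ-≤ k (∣A∪⁅x⁆∣≤1+∣A∣ A x)) (≤-reflexive (sym (+-suc ∣ A ∣ k))))

sequences : (n k : ℕ) → List (Vec (Fin n) k)
sequences n k = allVecs (allFin n) k

-- When ∣ A ∣ + k ≡ n, the sequences of length k covering the complement of A are exactly its
-- orderings.
∑-completions : Subset n → (k : ℕ) → (Vec (Fin n) k → ℕ) → ℕ
∑-completions A k F = ∑[ v ∈ sequences _ k ] 𝟙 (covers A v) * F v

∑-completions-cong : (A : Subset n) (k : ℕ) {F G : Vec (Fin n) k → ℕ} → (∀ v → F v ≡ G v) →
  ∑-completions A k F ≡ ∑-completions A k G
∑-completions-cong A k F≗G = ∑-cong (sequences _ k) (λ v → cong (𝟙 (covers A v) *_) (F≗G v))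

∑-completions-∷ : (A : Subset n) (F : Vec (Fin n) (suc k) → ℕ) → ∣ A ∣ + suc k ≡ n →
  ∑-completions A (suc k) F ≡ ∑[ x ∉ A ] ∑-completions (A ∪ ⁅ x ⁆) k (F ∘ (x ∷_))
∑-completions-∷ {n} {k} A F size =
  ∑-allVecs-suc (λ v → 𝟙 (covers A v) * F v) (allFin n) ∙ ∑-cong (allFin n) (λ x → by-head x (x ∈? A))
  where
  by-head : ∀ x (x∈?A : Dec (x ∈ A)) → ∑[ w ∈ sequences n k ] 𝟙 (covers A (x ∷ w)) * F (x ∷ w)
                                        ≡ χ (¬? x∈?A) * ∑-completions (A ∪ ⁅ x ⁆) k (F ∘ (x ∷_))
  by-head x (yes x∈A) = ∑-zero (sequences n k) (λ w → cong (λ b → 𝟙 b * F (x ∷ w)) (uncovered w))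
    where
    uncovered : ∀ w → covers A (x ∷ w) ≡ false
    uncovered w with covers A (x ∷ w) in covered
    ... | false = refl
    ... | true = ⊥-elim (<-irrefl refl (≤-trans (s≤s (covers⇒n≤∣A∣+k A w covered′))
                                              (≤-reflexive (sym (+-suc ∣ A ∣ k) ∙ size))))
      where
      covered′ : covers A w ≡ true
      covered′ = sym (covers-∷ A x w ∙ cong (λ B → covers B w) (x∈A⇒A∪⁅x⁆≡A x∈A)) ∙ covered
  by-head x (no _) =
    ∑-cong (sequences n k) (λ w → cong (λ b → 𝟙 b * F (x ∷ w)) (covers-∷ A x w)) ∙ sym (+-identityʳ _)

∑-completions-const : (A : Subset n) (c : ℕ) → ∣ A ∣ + k ≡ n → ∑-completions A k (λ _ → c) ≡ k ! * c
∑-completions-const {k = zero} A c size =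
  cong (λ b → 𝟙 b * c + 0) (∣A∣≡n⇒covers-[] A (sym (+-identityʳ ∣ A ∣) ∙ size)) ∙ +-identityʳ _
∑-completions-const {n} {suc k} A c size = begin
  ∑-completions A (suc k) (λ _ → c)
    ≡⟨ ∑-completions-∷ A _ size ⟩
  ∑[ x ∉ A ] ∑-completions (A ∪ ⁅ x ⁆) k (λ _ → c)
    ≡⟨ ∑∉-cong A (λ x x∉A → ∑-completions-const (A ∪ ⁅ x ⁆) c (x∉A⇒∣A∪⁅x⁆∣+k≡∣A∣+1+k x∉A ∙ size)) ⟩
  ∑[ x ∉ A ] k ! * c
    ≡⟨ ∑∉-const A (k ! * c) ⟩
  (n ∸ ∣ A ∣) * (k ! * c)
    ≡⟨ cong (_* (k ! * c)) (cong (_∸ ∣ A ∣) (sym size) ∙ m+n∸m≡n ∣ A ∣ (suc k)) ⟩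
  suc k * (k ! * c)
    ≡⟨ sym (*-assoc (suc k) (k !) c) ⟩
  suc k ! * c ∎
  where open ≡-Reasoning

prefixUnion : Subset n → ℕ → Vec (Fin n) k → Subset n
prefixUnion A zero v = A
prefixUnion A (suc i) [] = A
prefixUnion A (suc i) (x ∷ v) = prefixUnion (A ∪ ⁅ x ⁆) i v

∑-completions-prefix : (k : ℕ) (A : Subset n) (a : ℕ) (F : Subset n → ℕ) → ∣ A ∣ + k ≡ n → a ≤ k →
  ∑-completions A k (F ∘ prefixUnion A a) ≡ a ! * (k ∸ a) ! * sumSupersets A (∣ A ∣ + a) F
∑-completions-prefix k A zero F size _ =
  ∑-completions-const A (F A) size ∙ cong (k ! *_) (sym (sumSupersets-self A F (+-identityʳ ∣ A ∣)))
  ∙ sym (cong (_* _) (*-identityˡ (k !)))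
∑-completions-prefix (suc k) A (suc a) F size (s≤s a≤k) = begin
  ∑-completions A (suc k) (F ∘ prefixUnion A (suc a))
    ≡⟨ ∑-completions-∷ A _ size ⟩
  ∑[ x ∉ A ] ∑-completions (A ∪ ⁅ x ⁆) k (F ∘ prefixUnion (A ∪ ⁅ x ⁆) a)
    ≡⟨ ∑∉-cong A (λ x x∉A → ∑-completions-prefix k (A ∪ ⁅ x ⁆) a F (x∉A⇒∣A∪⁅x⁆∣+k≡∣A∣+1+k x∉A ∙ size) a≤k
                             ∙ cong (λ m → K * sumSupersets (A ∪ ⁅ x ⁆) m F) (x∉A⇒∣A∪⁅x⁆∣+k≡∣A∣+1+k x∉A)) ⟩
  ∑[ x ∉ A ] K * sumSupersets (A ∪ ⁅ x ⁆) (∣ A ∣ + suc a) F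
    ≡⟨ ∑∉-*ˡ A K (λ x → sumSupersets (A ∪ ⁅ x ⁆) (∣ A ∣ + suc a) F) ⟩
  K * (∑[ x ∉ A ] sumSupersets (A ∪ ⁅ x ⁆) (∣ A ∣ + suc a) F)
    ≡⟨ cong (K *_) (∑∉-sumSupersets A (∣ A ∣ + suc a) F) ⟩
  K * ((∣ A ∣ + suc a ∸ ∣ A ∣) * sumSupersets A (∣ A ∣ + suc a) F)
    ≡⟨ cong (λ c → K * (c * sumSupersets A (∣ A ∣ + suc a) F)) (m+n∸m≡n ∣ A ∣ (suc a)) ⟩
  K * (suc a * sumSupersets A (∣ A ∣ + suc a) F)
    ≡⟨ rearrange (a !) ((k ∸ a) !) (suc a) _ ⟩
  suc a ! * (k ∸ a) ! * sumSupersets A (∣ A ∣ + suc a) F ∎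
  where
  open ≡-Reasoning
  K = a ! * (k ∸ a) !
  rearrange : ∀ f g c s → f * g * (c * s) ≡ c * f * g * s
  rearrange = solve 4 (λ f g c s → f :* g :* (c :* s) := c :* f :* g :* s) refl

chainSum : Subset n → ℕ → ℕ → (Subset n → Subset n → ℕ) → ℕ
chainSum A j a G = sumSupersets A (∣ A ∣ + j) (λ U → sumSupersets U (∣ A ∣ + a) (G U))

chainSum-∪⁅⁆ : {x : Fin n} (A : Subset n) (j a : ℕ) (G : Subset n → Subset n → ℕ) → x ∉ A →
  chainSum (A ∪ ⁅ x ⁆) j a G ≡ sumSupersets (A ∪ ⁅ x ⁆) (∣ A ∣ + suc j) (λ U → sumSupersets U (∣ A ∣ + suc a) (G U))
chainSum-∪⁅⁆ {x = x} A j a G x∉A =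
  cong₂ (λ p q → sumSupersets (A ∪ ⁅ x ⁆) p (λ U → sumSupersets U q (G U)))
        (x∉A⇒∣A∪⁅x⁆∣+k≡∣A∣+1+k {k = j} x∉A) (x∉A⇒∣A∪⁅x⁆∣+k≡∣A∣+1+k {k = a} x∉A)

∑-completions-prefixes : (k : ℕ) (A : Subset n) (j a : ℕ) (G : Subset n → Subset n → ℕ) →
  ∣ A ∣ + k ≡ n → j ≤ a → a ≤ k →
  ∑-completions A k (λ v → G (prefixUnion A j v) (prefixUnion A a v))
  ≡ j ! * (a ∸ j) ! * (k ∸ a) ! * chainSum A j a G
∑-completions-prefixes k A zero a G size _ a≤k =
  ∑-completions-prefix k A a (G A) size a≤k
  ∙ cong (a ! * (k ∸ a) ! *_) (sym (sumSupersets-self A _ (+-identityʳ ∣ A ∣)))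
  ∙ sym (cong (λ c → c * (k ∸ a) ! * chainSum A 0 a G) (*-identityˡ (a !)))
∑-completions-prefixes (suc k) A (suc j) (suc a) G size (s≤s j≤a) (s≤s a≤k) = begin
  ∑-completions A (suc k) (λ v → G (prefixUnion A (suc j) v) (prefixUnion A (suc a) v))
    ≡⟨ ∑-completions-∷ A _ size ⟩
  ∑[ x ∉ A ] ∑-completions (A ∪ ⁅ x ⁆) k (λ v → G (prefixUnion (A ∪ ⁅ x ⁆) j v) (prefixUnion (A ∪ ⁅ x ⁆) a v))
    ≡⟨ ∑∉-cong A (λ x x∉A → ∑-completions-prefixes k (A ∪ ⁅ x ⁆) j a G (x∉A⇒∣A∪⁅x⁆∣+k≡∣A∣+1+k x∉A ∙ size) j≤a a≤k
                             ∙ cong (K *_) (chainSum-∪⁅⁆ A j a G x∉A)) ⟩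
  ∑[ x ∉ A ] K * sumSupersets (A ∪ ⁅ x ⁆) (∣ A ∣ + suc j) H
    ≡⟨ ∑∉-*ˡ A K (λ x → sumSupersets (A ∪ ⁅ x ⁆) (∣ A ∣ + suc j) H) ⟩
  K * (∑[ x ∉ A ] sumSupersets (A ∪ ⁅ x ⁆) (∣ A ∣ + suc j) H)
    ≡⟨ cong (K *_) (∑∉-sumSupersets A (∣ A ∣ + suc j) H) ⟩
  K * ((∣ A ∣ + suc j ∸ ∣ A ∣) * chainSum A (suc j) (suc a) G)
    ≡⟨ cong (λ c → K * (c * chainSum A (suc j) (suc a) G)) (m+n∸m≡n ∣ A ∣ (suc j)) ⟩
  K * (suc j * chainSum A (suc j) (suc a) G)
    ≡⟨ rearrange (j !) ((a ∸ j) !) ((k ∸ a) !) (suc j) _ ⟩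
  suc j ! * (a ∸ j) ! * (k ∸ a) ! * chainSum A (suc j) (suc a) G ∎
  where
  open ≡-Reasoning
  K = j ! * (a ∸ j) ! * (k ∸ a) !
  H : Subset _ → ℕ
  H U = sumSupersets U (∣ A ∣ + suc a) (G U)
  rearrange : ∀ f g h c s → f * g * h * (c * s) ≡ c * f * g * h * s
  rearrange = solve 5 (λ f g h c s → f :* g :* h :* (c :* s) := c :* f :* g :* h :* s) refl

-- Matroids: prefix ranks and coloops

module _ (M : Matroid n) where

  private
    r : Subset n → ℕ
    r = rank M

  rank-⊥ : r ⊥ ≡ 0
  rank-⊥ = n≤0⇒n≡0 (subst (r ⊥ ≤_) (∣⊥∣≡0 n) (rank-bound M ⊥))

  sum-take-rankSeqFrom : (A : Subset n) (i : ℕ) (v : Vec (Fin n) k) →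
    sum (take i (rankSeqFrom r A v)) + r A ≡ r (prefixUnion A i v)
  sum-take-rankSeqFrom A zero v = refl
  sum-take-rankSeqFrom A (suc i) [] = refl
  sum-take-rankSeqFrom A (suc i) (x ∷ v) = begin
    r (A ∪ ⁅ x ⁆) ∸ r A + s + r A    ≡⟨ +-xy∙z≈y∙xz (r (A ∪ ⁅ x ⁆) ∸ r A) s (r A) ⟩
    s + (r (A ∪ ⁅ x ⁆) ∸ r A + r A)  ≡⟨ cong (s +_) (m∸n+n≡m (rank-mono M (p⊆p∪q ⁅ x ⁆))) ⟩
    s + r (A ∪ ⁅ x ⁆)                ≡⟨ sum-take-rankSeqFrom (A ∪ ⁅ x ⁆) i v ⟩
    r (prefixUnion (A ∪ ⁅ x ⁆) i v)  ∎
    where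
    open ≡-Reasoning
    s = sum (take i (rankSeqFrom r (A ∪ ⁅ x ⁆) v))

  sum-take-rankSeq : (i : ℕ) (π : Vec (Fin n) n) → sum (take i (rankSeq M π)) ≡ r (prefixUnion ⊥ i π)
  sum-take-rankSeq i π =
    sym (+-identityʳ _) ∙ cong (sum (take i (rankSeq M π)) +_) (sym rank-⊥) ∙ sum-take-rankSeqFrom ⊥ i π

  rank-∪-≤ : (X Y : Subset n) → r (X ∪ Y) ≤ r X + ∣ Y ∣
  rank-∪-≤ X Y = ≤-trans (m≤m+n _ _) (≤-trans (rank-submod M X Y) (+-monoʳ-≤ (r X) (rank-bound M Y)))

  rank-≤-+-∣∖∣ : (U S : Subset n) → r S ≤ r U + ∣ S ∖ U ∣
  rank-≤-+-∣∖∣ U S = ≤-trans (rank-mono M (S⊆U∪[S∖U] U S)) (rank-∪-≤ U (S ∖ U))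

  coloopSet : Subset n → Subset n
  coloopSet S = tabulate (λ e → r (S ∖ ⁅ e ⁆) <ᵇ r S)

  ∈-coloopSet⇔ : {S : Subset n} {e : Fin n} → e ∈ coloopSet S ⇔ r (S ∖ ⁅ e ⁆) < r S
  ∈-coloopSet⇔ {S} {e} = mk⇔
    (λ e∈C → <ᵇ⇒< _ _ (Equivalence.from T-≡ (sym (lookup∘tabulate _ e) ∙ []=⇒lookup e∈C)))
    (λ lt → lookup⇒[]= e _ (lookup∘tabulate _ e ∙ Equivalence.to T-≡ (<⇒<ᵇ lt)))

  coloops≡∣∩coloopSet∣ : (S : Subset n) → coloops M S ≡ ∣ S ∩ coloopSet S ∣
  coloops≡∣∩coloopSet∣ S = count≡∑ _ (allFin n) ∙ ∑-cong (allFin n) lookup-∩ ∙ sym (∣X∣≡∑ (S ∩ coloopSet S))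
    where
    lookup-∩ : ∀ e → 𝟙 (lookup S e ∧ (r (S [ e ]≔ false) <ᵇ r S)) ≡ 𝟙 (lookup (S ∩ coloopSet S) e)
    lookup-∩ e = cong 𝟙 (cong (λ X → lookup S e ∧ (r X <ᵇ r S)) (sym (X∖⁅x⁆≡X[x]≔false S e))
                        ∙ cong (lookup S e ∧_) (sym (lookup∘tabulate _ e)) ∙ sym (lookup-zipWith _∧_ e S _))

  rank-tight⇒∖⊆coloopSet : (U S : Subset n) → r U + ∣ S ∖ U ∣ ≡ r S → S ∖ U ⊆ coloopSet S
  rank-tight⇒∖⊆coloopSet U S tight {e} e∈S∖U with e ∈? coloopSet S
  ... | yes e∈C = e∈C
  ... | no e∉C = ⊥-elim (<-irrefl refl (begin-strict
    r S                          ≤⟨ ≮⇒≥ (e∉C ∘ Equivalence.from ∈-coloopSet⇔) ⟩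
    r (S ∖ ⁅ e ⁆)                ≤⟨ rank-≤-+-∣∖∣ U (S ∖ ⁅ e ⁆) ⟩
    r U + ∣ S ∖ ⁅ e ⁆ ∖ U ∣      ≡⟨ cong (λ X → r U + ∣ X ∣) (∖-comm S ⁅ e ⁆ U) ⟩
    r U + ∣ S ∖ U ∖ ⁅ e ⁆ ∣      <⟨ +-monoʳ-< (r U) (≤-reflexive (sym (x∈X⇒∣X∣≡1+∣X∖⁅x⁆∣ e∈S∖U))) ⟩
    r U + ∣ S ∖ U ∣              ≡⟨ tight ⟩
    r S                          ∎))
    where open ≤-Reasoning

  -- Submodularity for S ∖ ⁅ e ⁆ and U ∪ ⁅ e ⁆, whose union contains S and whose intersection contains U.
  coloop-raises-rank : {U S : Subset n} {e : Fin n} → U ⊆ S → e ∈ S → e ∉ U → e ∈ coloopSet S →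
    r U < r (U ∪ ⁅ e ⁆)
  coloop-raises-rank {U} {S} {e} U⊆S e∈S e∉U e∈C = +-cancelˡ-< (r S) (r U) (r U′) (begin-strict
    r S + r U                  ≤⟨ +-mono-≤ (rank-mono M S⊆S′∪U′) (rank-mono M U⊆S′∩U′) ⟩
    r (S′ ∪ U′) + r (S′ ∩ U′)  ≤⟨ rank-submod M S′ U′ ⟩
    r S′ + r U′                <⟨ +-monoˡ-< (r U′) (Equivalence.to ∈-coloopSet⇔ e∈C) ⟩
    r S + r U′                 ∎)
    where
    open ≤-Reasoning
    U′ = U ∪ ⁅ e ⁆
    S′ = S ∖ ⁅ e ⁆
    S⊆S′∪U′ : S ⊆ S′ ∪ U′
    S⊆S′∪U′ {x} x∈S with x Fin.≟ e
    ... | yes refl = q⊆p∪q S′ U′ (q⊆p∪q U ⁅ x ⁆ (x∈⁅x⁆ x))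
    ... | no x≢e = p⊆p∪q U′ (x∈p∩q⁺ (x∈S , x∉p⇒x∈∁p (x≢y⇒x∉⁅y⁆ x≢e)))
    U⊆S′∩U′ : U ⊆ S′ ∩ U′
    U⊆S′∩U′ {x} x∈U =
      x∈p∩q⁺ (x∈p∩q⁺ (U⊆S x∈U , x∉p⇒x∈∁p (x≢y⇒x∉⁅y⁆ (λ { refl → e∉U x∈U }))) , p⊆p∪q ⁅ e ⁆ x∈U)

  ∖⊆coloopSet⇒rank-tight : (d : ℕ) (U S : Subset n) → U ⊆ S → ∣ S ∖ U ∣ ≡ d → S ∖ U ⊆ coloopSet S →
    r U + d ≤ r S
  ∖⊆coloopSet⇒rank-tight zero U S U⊆S _ _ = ≤-trans (≤-reflexive (+-identityʳ (r U))) (rank-mono M U⊆S)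
  ∖⊆coloopSet⇒rank-tight (suc d) U S U⊆S size S∖U⊆C with e , e∈S∖U ← ∣X∣≡1+d⇒Nonempty size = begin
    r U + suc d    ≡⟨ +-suc (r U) d ⟩
    suc (r U) + d  ≤⟨ +-monoˡ-≤ d (coloop-raises-rank U⊆S e∈S e∉U (S∖U⊆C e∈S∖U)) ⟩
    r U′ + d       ≤⟨ ∖⊆coloopSet⇒rank-tight d U′ S U′⊆S size′ (⊆-trans S∖U′⊆S∖U S∖U⊆C) ⟩
    r S            ∎
    where
    open ≤-Reasoning
    e∈S : e ∈ S
    e∈S = proj₁ (x∈p∩q⁻ S (∁ U) e∈S∖U)
    e∉U : e ∉ U
    e∉U = x∈∁p⇒x∉p (proj₂ (x∈p∩q⁻ S (∁ U) e∈S∖U))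
    U′ = U ∪ ⁅ e ⁆
    U′⊆S : U′ ⊆ S
    U′⊆S x∈U′ with x∈p∪q⁻ U ⁅ e ⁆ x∈U′
    ... | inj₁ x∈U = U⊆S x∈U
    ... | inj₂ x∈⁅e⁆ = subst (_∈ S) (sym (x∈⁅y⁆⇒x≡y e x∈⁅e⁆)) e∈S
    S∖U′⊆S∖U : S ∖ U′ ⊆ S ∖ U
    S∖U′⊆S∖U x∈S∖U′ = let x∈S , x∈∁U′ = x∈p∩q⁻ S (∁ U′) x∈S∖U′ in
                      x∈p∩q⁺ (x∈S , p⊆q⇒∁p⊇∁q (p⊆p∪q ⁅ e ⁆) x∈∁U′)
    size′ : ∣ S ∖ U′ ∣ ≡ d
    size′ = suc-injective (+-cancelˡ-≡ ∣ U ∣ _ _ (+-suc ∣ U ∣ _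
              ∙ cong (_+ ∣ S ∖ U′ ∣) (sym (x∉A⇒∣A∪⁅x⁆∣≡1+∣A∣ e∉U)) ∙ sym (U⊆S⇒∣S∣≡∣U∣+∣S∖U∣ U′⊆S)
              ∙ U⊆S⇒∣S∣≡∣U∣+∣S∖U∣ U⊆S ∙ cong (∣ U ∣ +_) size))

  rank-tight⇔∖⊆coloopSet : {U S : Subset n} → U ⊆ S → (r U + ∣ S ∖ U ∣ ≡ r S) ⇔ (S ∖ U ⊆ coloopSet S)
  rank-tight⇔∖⊆coloopSet {U} {S} U⊆S = mk⇔ (rank-tight⇒∖⊆coloopSet U S)
    (λ S∖U⊆C → ≤-antisym (∖⊆coloopSet⇒rank-tight _ U S U⊆S refl S∖U⊆C) (rank-≤-+-∣∖∣ U S))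

  ∑-⊆-rank-tight : (S : Subset n) (j t : ℕ) → ∣ S ∣ ≡ j + t →
    ∑[ U ∈ allSubsets n ] χ (U ⊆? S) * (χ (∣ U ∣ ≟ j) * χ (r U + t ≟ r S)) ≡ coloops M S C t
  ∑-⊆-rank-tight S j t size =
    ∑-cong (allSubsets n) (λ U → χ-guard (U ⊆? S) (λ U⊆S → tight≡removal U⊆S (∣ U ∣ ≟ j)))
    ∙ ∑-removal S (coloopSet S) t ∙ cong (_C t) (sym (coloops≡∣∩coloopSet∣ S))
    where
    tight≡removal : {U : Subset n} → U ⊆ S → (d : Dec (∣ U ∣ ≡ j)) →
      χ d * χ (r U + t ≟ r S) ≡ χ (S ∖ U ⊆? coloopSet S) * χ (∣ S ∖ U ∣ ≟ t)
    tight≡removal {U} U⊆S (yes refl) =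
      *-identityˡ _ ∙ cong (λ k → χ (r U + k ≟ r S)) (sym co-size)
      ∙ cong 𝟙 (does-⇔ (rank-tight⇔∖⊆coloopSet U⊆S) (_ ≟ _) (S ∖ U ⊆? coloopSet S))
      ∙ sym (cong (χ (S ∖ U ⊆? coloopSet S) *_) (χ-yes (∣ S ∖ U ∣ ≟ t) co-size) ∙ *-identityʳ _)
      where
      co-size : ∣ S ∖ U ∣ ≡ t
      co-size = +-cancelˡ-≡ ∣ U ∣ _ _ (sym (U⊆S⇒∣S∣≡∣U∣+∣S∖U∣ U⊆S) ∙ size)
    tight≡removal {U} U⊆S (no ∣U∣≢j) =
      sym (cong (χ (S ∖ U ⊆? coloopSet S) *_) (χ-no (∣ S ∖ U ∣ ≟ t) co-size≢t)
           ∙ *-zeroʳ (χ (S ∖ U ⊆? coloopSet S)))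
      where
      co-size≢t : ∣ S ∖ U ∣ ≢ t
      co-size≢t co-size =
        ∣U∣≢j (+-cancelʳ-≡ t ∣ U ∣ j (cong (∣ U ∣ +_) (sym co-size) ∙ sym (U⊆S⇒∣S∣≡∣U∣+∣S∖U∣ U⊆S) ∙ size))

  coloopMoment : (a b t : ℕ) → ℕ
  coloopMoment a b t = ∑[ S ∈ allSubsets n ] χ (∣ S ∣ ≟ a) * (χ (r S ≟ b) * (coloops M S C t))

  coloopMoment-oversized : {a : ℕ} (b t : ℕ) → n < a → coloopMoment a b t ≡ 0
  coloopMoment-oversized {a} b t n<a = ∑-zero (allSubsets n) (λ S →
    cong (_* (χ (r S ≟ b) * (coloops M S C t)))
         (χ-no (∣ S ∣ ≟ a) (λ ∣S∣≡a → <⇒≱ n<a (subst (_≤ n) ∣S∣≡a (∣p∣≤n S)))))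

  tightness : (b t : ℕ) → Subset n → Subset n → ℕ
  tightness b t U S = χ (r S ≟ b) * χ (r U + t ≟ r S)

  chainSum-⊥-tightness : (j t a b : ℕ) → j + t ≡ a → chainSum ⊥ j a (tightness b t) ≡ coloopMoment a b t
  chainSum-⊥-tightness j t a b j+t≡a = begin
    chainSum ⊥ j a (tightness b t)
      ≡⟨ cong₂ (λ p q → sumSupersets ⊥ (p + j) (λ U → sumSupersets U (q + a) (tightness b t U)))
               (∣⊥∣≡0 n) (∣⊥∣≡0 n) ⟩
    ∑[ U ∈ allSubsets n ] χ (⊥ ⊆? U) * (χ (∣ U ∣ ≟ j) * sumSupersets U a (tightness b t U))
      ≡⟨ ∑-cong (allSubsets n) drop-⊥ ⟩
    ∑[ U ∈ allSubsets n ] ∑[ S ∈ allSubsets n ] term U S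
      ≡⟨ ∑-comm term (allSubsets n) (allSubsets n) ⟩
    ∑[ S ∈ allSubsets n ] ∑[ U ∈ allSubsets n ] term U S
      ≡⟨ ∑-cong (allSubsets n) factor-S ⟩
    ∑[ S ∈ allSubsets n ] χ (∣ S ∣ ≟ a) * (χ (r S ≟ b) * tightSubsets S)
      ≡⟨ ∑-cong (allSubsets n) (λ S → χ-guard (∣ S ∣ ≟ a) (λ ∣S∣≡a →
           cong (χ (r S ≟ b) *_) (∑-⊆-rank-tight S j t (∣S∣≡a ∙ sym j+t≡a)))) ⟩
    coloopMoment a b t ∎
    where
    open ≡-Reasoning
    term : Subset n → Subset n → ℕ
    term U S = χ (∣ U ∣ ≟ j) * (χ (U ⊆? S) * (χ (∣ S ∣ ≟ a) * tightness b t U S))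
    tightSubsets : Subset n → ℕ
    tightSubsets S = ∑[ U ∈ allSubsets n ] χ (U ⊆? S) * (χ (∣ U ∣ ≟ j) * χ (r U + t ≟ r S))
    drop-⊥ : ∀ U → χ (⊥ ⊆? U) * (χ (∣ U ∣ ≟ j) * sumSupersets U a (tightness b t U)) ≡ ∑[ S ∈ allSubsets n ] term U S
    drop-⊥ U = cong (_* (χ (∣ U ∣ ≟ j) * sumSupersets U a (tightness b t U))) (χ-yes (⊥ ⊆? U) ⊥⊆)
               ∙ *-identityˡ _ ∙ sym (∑-*ˡ (χ (∣ U ∣ ≟ j)) _ (allSubsets n))
    reorder : ∀ u v w x y → u * (v * (w * (x * y))) ≡ w * (x * (v * (u * y)))
    reorder = solve 5 (λ u v w x y → u :* (v :* (w :* (x :* y))) := w :* (x :* (v :* (u :* y)))) refl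
    factor-S : ∀ S → ∑[ U ∈ allSubsets n ] term U S ≡ χ (∣ S ∣ ≟ a) * (χ (r S ≟ b) * tightSubsets S)
    factor-S S =
      ∑-cong (allSubsets n) (λ U →
        reorder (χ (∣ U ∣ ≟ j)) (χ (U ⊆? S)) (χ (∣ S ∣ ≟ a)) (χ (r S ≟ b)) (χ (r U + t ≟ r S)))
      ∙ ∑-*ˡ (χ (∣ S ∣ ≟ a)) _ (allSubsets n) ∙ cong (χ (∣ S ∣ ≟ a) *_) (∑-*ˡ (χ (r S ≟ b)) _ (allSubsets n))

-- Rank sequences and the 𝒢-invariant

rankSequences : Matroid n → List (List ℕ)
rankSequences M = map (rankSeq M) (filterᵇ isBijection (sequences _ _))

Ginv≡count : (M : Matroid n) (s : List ℕ) → Ginv M s ≡ count (λ l → listEqᵇ l s) (rankSequences M)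
Ginv≡count M s = count-∧-map isBijection (λ l → listEqᵇ l s) (rankSeq M) (sequences _ _)

count-rankSequences : (M : Matroid n) (q : List ℕ → Bool) →
  count q (rankSequences M) ≡ ∑-completions ⊥ n (λ π → 𝟙 (q (rankSeq M π)))
count-rankSequences {n} M q =
  sym (count-∧-map isBijection q (rankSeq M) (sequences n n)) ∙ count≡∑ _ (sequences n n)
  ∙ ∑-cong (sequences n n) (λ π → 𝟙-∧ (isBijection π) (q (rankSeq M π))
                                  ∙ cong (λ b → 𝟙 b * 𝟙 (q (rankSeq M π))) (isBijection≡covers⊥ π))

listEqᵇ-refl : (l : List ℕ) → listEqᵇ l l ≡ true
listEqᵇ-refl [] = refl
listEqᵇ-refl (a ∷ l) = cong₂ _∧_ (Equivalence.to T-≡ (≡⇒≡ᵇ a a refl)) (listEqᵇ-refl l)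

listEqᵇ-sound : (l s : List ℕ) → listEqᵇ l s ≡ true → l ≡ s
listEqᵇ-sound [] [] _ = refl
listEqᵇ-sound (a ∷ l) (b ∷ s) eq with a ≡ᵇ b in a≡ᵇb
... | true = cong₂ _∷_ (≡ᵇ⇒≡ a b (Equivalence.from T-≡ a≡ᵇb)) (listEqᵇ-sound l s eq)

same-Ginv⇒same-counts : {m : ℕ} (M : Matroid n) (N : Matroid m) → (∀ s → Ginv M s ≡ Ginv N s) →
  ∀ q → count q (rankSequences M) ≡ count q (rankSequences N)
same-Ginv⇒same-counts M N same-Ginv =
  same-multiplicities⇒same-counts listEqᵇ listEqᵇ-refl listEqᵇ-sound (rankSequences M) (rankSequences N)
    (λ s → sym (Ginv≡count M s) ∙ same-Ginv s ∙ Ginv≡count N s)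

length-rankSeqFrom : (r : Subset n → ℕ) (A : Subset n) (v : Vec (Fin n) k) → length (rankSeqFrom r A v) ≡ k
length-rankSeqFrom r A [] = refl
length-rankSeqFrom r A (x ∷ v) = cong suc (length-rankSeqFrom r (A ∪ ⁅ x ⁆) v)

count-length : {m : ℕ} (M : Matroid m) (n : ℕ) → count (λ l → length l ≡ᵇ n) (rankSequences M) ≡ m ! * χ (m ≟ n)
count-length {m} M n =
  count-rankSequences M _
  ∙ ∑-completions-cong ⊥ m (λ π → cong (λ k → 𝟙 (k ≡ᵇ n)) (length-rankSeqFrom (rank M) ⊥ π))
  ∙ ∑-completions-const ⊥ (χ (m ≟ n)) (cong (_+ m) (∣⊥∣≡0 m))

same-counts⇒same-size : {m : ℕ} (M : Matroid n) (N : Matroid m) →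
  (∀ q → count q (rankSequences M) ≡ count q (rankSequences N)) → n ≡ m
same-counts⇒same-size {n} {m} M N same with m ≟ n
... | yes m≡n = sym m≡n
... | no m≢n = ⊥-elim (<⇒≢ (1≤n! n) (sym n!≡0))
  where
  n!≡0 : n ! ≡ 0
  n!≡0 = sym (*-identityʳ (n !)) ∙ cong (n ! *_) (sym (χ-yes (n ≟ n) refl)) ∙ sym (count-length M n)
         ∙ same _ ∙ count-length N n ∙ cong (m ! *_) (χ-no (m ≟ n) m≢n) ∙ *-zeroʳ (m !)

prefixEvent : (j t a b : ℕ) → List ℕ → Bool
prefixEvent j t a b l = (sum (take a l) ≡ᵇ b) ∧ (sum (take j l) + t ≡ᵇ sum (take a l))

count-prefixEvent : (M : Matroid n) (j t a b : ℕ) → j + t ≡ a → a ≤ n →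
  count (prefixEvent j t a b) (rankSequences M) ≡ j ! * (a ∸ j) ! * (n ∸ a) ! * coloopMoment M a b t
count-prefixEvent {n} M j t a b j+t≡a a≤n =
  count-rankSequences M _
  ∙ ∑-completions-cong ⊥ n (λ π → 𝟙-∧ (sum (take a (rankSeq M π)) ≡ᵇ b) _
                                   ∙ cong₂ (λ x y → χ (x ≟ b) * χ (y + t ≟ x))
                                           (sum-take-rankSeq M a π) (sum-take-rankSeq M j π))
  ∙ ∑-completions-prefixes n ⊥ j a (tightness M b t) (cong (_+ n) (∣⊥∣≡0 n))
                           (≤-trans (m≤m+n j t) (≤-reflexive j+t≡a)) a≤n
  ∙ cong (j ! * (a ∸ j) ! * (n ∸ a) ! *_) (chainSum-⊥-tightness M j t a b j+t≡a)

same-counts⇒same-coloopMoments : (M N : Matroid n) → (∀ q → count q (rankSequences M) ≡ count q (rankSequences N)) →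
  ∀ a b t → t ≤ a → coloopMoment M a b t ≡ coloopMoment N a b t
same-counts⇒same-coloopMoments {n} M N same a b t t≤a with a ≤? n
... | no a≰n = coloopMoment-oversized M b t (≰⇒> a≰n) ∙ sym (coloopMoment-oversized N b t (≰⇒> a≰n))
... | yes a≤n = *-cancelˡ-≡ _ _ K {{K≢0}}
  (sym (count-prefixEvent M j t a b j+t≡a a≤n) ∙ same _ ∙ count-prefixEvent N j t a b j+t≡a a≤n)
  where
  j = a ∸ t
  j+t≡a : j + t ≡ a
  j+t≡a = m∸n+n≡m t≤a
  K = j ! * (a ∸ j) ! * (n ∸ a) !
  K≢0 : NonZero K
  K≢0 = m*n≢0 _ _ {{j !* (a ∸ j) !≢0}} {{(n ∸ a) !≢0}}

module _ (M : Matroid n) (a b : ℕ) where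

  private
    sizeRank : Subset n → Bool
    sizeRank S = (∣ S ∣ ≡ᵇ a) ∧ (rank M S ≡ᵇ b)

  coloopNumbers : List ℕ
  coloopNumbers = map (coloops M) (filterᵇ sizeRank (allSubsets n))

  srcData≡count : (c : ℕ) → srcData M (a , b , c) ≡ count (_≡ᵇ c) coloopNumbers
  srcData≡count c = count-cong (allSubsets n) (λ S → sym (∧-assoc (∣ S ∣ ≡ᵇ a) _ _))
                    ∙ count-∧-map sizeRank (_≡ᵇ c) (coloops M) (allSubsets n)

  coloopMoment≡∑ : (t : ℕ) → coloopMoment M a b t ≡ ∑[ x ∈ coloopNumbers ] x C t
  coloopMoment≡∑ t =
    ∑-cong (allSubsets n) (λ S → sym (*-assoc (χ (∣ S ∣ ≟ a)) (χ (rank M S ≟ b)) (coloops M S C t))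
                                ∙ cong (_* (coloops M S C t)) (sym (𝟙-∧ (∣ S ∣ ≡ᵇ a) (rank M S ≡ᵇ b))))
    ∙ ∑-filterᵇ-map sizeRank (coloops M) (_C t) (allSubsets n)

  coloopNumbers-bounded : All (_< suc a) coloopNumbers
  coloopNumbers-bounded = map⁺ (All.map bounded (all-filter (T? ∘ sizeRank) (allSubsets n)))
    where
    bounded : {S : Subset n} → T (sizeRank S) → coloops M S < suc a
    bounded {S} sizeRank-S = s≤s (begin
      coloops M S             ≡⟨ coloops≡∣∩coloopSet∣ M S ⟩
      ∣ S ∩ coloopSet M S ∣   ≤⟨ ∣p∩q∣≤∣p∣ S _ ⟩
      ∣ S ∣                   ≡⟨ ≡ᵇ⇒≡ ∣ S ∣ a (proj₁ (Equivalence.to T-∧ sizeRank-S)) ⟩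
      a                       ∎)
      where open ≤-Reasoning

same-counts⇒same-srcData : (M N : Matroid n) → (∀ q → count q (rankSequences M) ≡ count q (rankSequences N)) →
  ∀ t → srcData M t ≡ srcData N t
same-counts⇒same-srcData M N same (a , b , c) =
  srcData≡count M a b c
  ∙ binomial-moments⇒multiplicities (suc a) (coloopNumbers-bounded M a b) (coloopNumbers-bounded N a b)
                                    same-moments c
  ∙ sym (srcData≡count N a b c)
  where
  same-moments : ∀ t → t < suc a → ∑[ x ∈ coloopNumbers M a b ] x C t ≡ ∑[ y ∈ coloopNumbers N a b ] y C t
  same-moments t t<1+a =
    sym (coloopMoment≡∑ M a b t) ∙ same-counts⇒same-coloopMoments M N same a b t (≤-pred t<1+a)
    ∙ coloopMoment≡∑ N a b t

theorem5p3 : {n m : ℕ} (M : Matroid n) (N : Matroid m) →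
    (∀ (s : List ℕ) → Ginv M s ≡ Ginv N s) →
    ∀ (t : ℕ × ℕ × ℕ) → srcData M t ≡ srcData N t
theorem5p3 M N same-Ginv with same-counts⇒same-size M N (same-Ginv⇒same-counts M N same-Ginv)
... | refl = same-counts⇒same-srcData M N (same-Ginv⇒same-counts M N same-Ginv)
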